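{- The program transformation (lbeta) of $L_{need,\oplus}$, relating $((\lambda x.s)\ t)$ to $\mathtt{let}\ x=t\ \mathtt{in}\ s$ for all variables $x$ and expressions $s,t$, is correct: $((\lambda x.s)\ t)\sim_c \mathtt{let}\ x=t\ \mathtt{in}\ s$.
   Context: Expressions of $L_{need,\oplus}$: $s,t,r ::= x \mid \lambda x.s \mid (s\,t) \mid (s\oplus t) \mid \mathtt{let}\ env\ \mathtt{in}\ s$, with $env$ a (possibly empty) multiset of bindings $x_1=s_1,\dots,x_n=s_n$ with pairwise distinct $x_i$ and recursive scope; up to $\alpha$-equivalence. $\{x_i=s_{f(i)}\}_{i=j}^m$ abbreviates $x_j=s_{f(j)},\dots,x_m=s_{f(m)}$. A context has one hole anywhere. $A ::= [\cdot]\mid (A\ s)$; reduction contexts $R ::= A \mid \mathtt{let}\ env\ \mathtt{in}\ A \mid \mathtt{let}\ env, \{x_i=A_i[x_{i+1}]\}_{i=1}^n, x_{n+1}=A_{n+1}\ \mathtt{in}\ A[x_1]$. Standard reduction: (lbeta) $R[((\lambda x.s)\ t)] \to R[\mathtt{let}\ x=t\ \mathtt{in}\ s]$; (probl) $R[s\oplus t]\to R[s]$; (probr) $R[s\oplus t]\to R[t]$; (lapp) $R[((\mathtt{let}\ env\ \mathtt{in}\ s)\ t)] \to R[\mathtt{let}\ env\ \mathtt{in}\ (s\ t)]$; (llet-in) $\mathtt{let}\ env_1\ \mathtt{in}\ (\mathtt{let}\ env_2\ \mathtt{in}\ s) \to \mathtt{let}\ env_1,env_2\ \mathtt{in}\ s$;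 (llet-e) $\mathtt{let}\ \{x_i=A_i[x_{i+1}]\}_{i=1}^{n-1}, x_n=(\mathtt{let}\ env_1\ \mathtt{in}\ s), env_2\ \mathtt{in}\ A[x_1] \to \mathtt{let}\ \{x_i=A_i[x_{i+1}]\}_{i=1}^{n-1}, x_n=s, env_1, env_2\ \mathtt{in}\ A[x_1]$; (cp-in) $\mathtt{let}\ \{x_i=x_{i+1}\}_{i=1}^{n-1}, x_n=\lambda y.s, env\ \mathtt{in}\ A[x_1] \to \mathtt{let}\ \{x_i=x_{i+1}\}_{i=1}^{n-1}, x_n=\lambda y.s, env\ \mathtt{in}\ A[\lambda y.s]$; (cp-e) $\mathtt{let}\ \{x_i=A_i[x_{i+1}]\}_{i=1}^{n-1}, x_n=A_n[y_1], \{y_j=y_{j+1}\}_{j=1}^{m-1}, y_m=\lambda z.s, env\ \mathtt{in}\ A[x_1] \to$ the same with $x_n=A_n[\lambda z.s]$, where $A_n\ne[\cdot]$, $n,m\ge1$. A WHNF is an abstraction or $\mathtt{let}\ env\ \mathtt{in}\ \lambda x.s$; an evaluation is a finite standard reduction sequence ending in a WHNF; its prob-length is its number of (probl)/(probr) steps. $\mathit{ExCv}(s)=\sum 2^{ -m}$ over all evaluations of $s$ with prob-length $m$. $s\le_c t$ iff $\mathit{ExCv}(C[s])\le\mathit{ExCv}(C[t])$ for all contexts $C$; $s\sim_c t$ iff both directions hold. A transformation is correct iff it is contained in $\sim_c$. -}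

module Defs where

open import Data.Nat using (ℕ; zero; suc; _+_)
open import Data.Nat.Properties using (+-assoc)
open import Data.Fin using (Fin; zero; suc; _↑ˡ_; _↑ʳ_; splitAt; cast)
open import Data.Sum using (inj₁; inj₂)
open import Data.Vec using (Vec; []; _∷_; lookup; _[_]≔_; _++_)
open import Data.List using (List; []; _∷_)
open import Data.List.Relation.Unary.All using (All)
open import Data.List.Relation.Unary.Unique.Propositional using (Unique)
open import Data.Product using (_×_; _,_; ∃)
open import Data.Rational using (ℚ; ½; 0ℚ; 1ℚ)
  renaming (_+_ to _+ℚ_; _*_ to _*ℚ_; _≤_ to _≤ℚ_)
open import Relation.Binary.PropositionalEquality using (_≡_; sym)

-- Expressions of L_need,⊕, in de Bruijn form (so α-equivalence is ≡).
-- Term n : expressions with n free variables.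
-- A letrec binding k variables: the k binders are the indices
-- 0..k-1 (i ↑ˡ n) of scope k + n, outer variables are k ↑ʳ j.
-- The binders scope over all right-hand sides and the body (recursive).
-- The multiset env is represented by a vector (its order is immaterial
-- for all rules below, which refer to bindings by index).

data Term : ℕ → Set where
  var  : ∀ {n} → Fin n → Term n
  lam  : ∀ {n} → Term (suc n) → Term n
  app  : ∀ {n} → Term n → Term n → Term n
  _⊕_  : ∀ {n} → Term n → Term n → Term n
  letr : ∀ {n} (k : ℕ) → Vec (Term (k + n)) k → Term (k + n) → Term n

ext : ∀ k {m n} → (Fin m → Fin n) → Fin (k + m) → Fin (k + n)
ext k {n = n} ρ i with splitAt k i
... | inj₁ j = j ↑ˡ n
... | inj₂ j = k ↑ʳ ρ j

mutual
  rename : ∀ {m n} → (Fin m → Fin n) → Term m → Term n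
  rename ρ (var i)      = var (ρ i)
  rename ρ (lam s)      = lam (rename (ext 1 ρ) s)
  rename ρ (app s t)    = app (rename ρ s) (rename ρ t)
  rename ρ (s ⊕ t)      = rename ρ s ⊕ rename ρ t
  rename ρ (letr k es b) = letr k (renameVec (ext k ρ) es) (rename (ext k ρ) b)

  renameVec : ∀ {m n k} → (Fin m → Fin n) → Vec (Term m) k → Vec (Term n) k
  renameVec ρ []       = []
  renameVec ρ (e ∷ es) = rename ρ e ∷ renameVec ρ es

wk : ∀ k {n} → Term n → Term (k + n)
wk k t = rename (k ↑ʳ_) t

-- moving terms into a merged let with k' + k binders
-- (inner binders first, then the outer ones)
reassoc : ∀ k' k n → Term (k' + (k + n)) → Term ((k' + k) + n)
reassoc k' k n = rename (cast (sym (+-assoc k' k n)))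

wkOuter : ∀ k' k n → Term (k + n) → Term ((k' + k) + n)
wkOuter k' k n t = reassoc k' k n (wk k' t)

-- General contexts (one hole anywhere); Ctx n m: outer scope n,
-- hole scope m.

data Ctx : ℕ → ℕ → Set where
  hole  : ∀ {n} → Ctx n n
  lamC  : ∀ {n m} → Ctx (suc n) m → Ctx n m
  appL  : ∀ {n m} → Ctx n m → Term n → Ctx n m
  appR  : ∀ {n m} → Term n → Ctx n m → Ctx n m
  orL   : ∀ {n m} → Ctx n m → Term n → Ctx n m
  orR   : ∀ {n m} → Term n → Ctx n m → Ctx n m
  letBody : ∀ {n m} (k : ℕ) → Vec (Term (k + n)) k → Ctx (k + n) m → Ctx n m
  letBind : ∀ {n m} (k₁ k₂ : ℕ)
          → Vec (Term ((k₁ + suc k₂) + n)) k₁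
          → Ctx ((k₁ + suc k₂) + n) m
          → Vec (Term ((k₁ + suc k₂) + n)) k₂
          → Term ((k₁ + suc k₂) + n)
          → Ctx n m

plug : ∀ {n m} → Ctx n m → Term m → Term n
plug hole s                  = s
plug (lamC C) s              = lam (plug C s)
plug (appL C t) s            = app (plug C s) t
plug (appR t C) s            = app t (plug C s)
plug (orL C t) s             = plug C s ⊕ t
plug (orR t C) s             = t ⊕ plug C s
plug (letBody k es C) s      = letr k es (plug C s)
plug (letBind k₁ k₂ pre C post b) s = letr (k₁ + suc k₂) (pre ++ (plug C s ∷ post)) b

-- Application contexts A ::= [.] | (A s), given by the list of
-- arguments (innermost first): plugA t (s₁ ∷ … ∷ sₖ) = (…((t s₁) s₂)… sₖ)

plugA : ∀ {n} → Term n → List (Term n) → Term n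
plugA t []       = t
plugA t (s ∷ ss) = plugA (app t s) ss

-- Chains in a letrec environment es.
-- Reach es i e : e = A₁[x₁], x₁ = A₂[x₂], …, x_{j-1} = A_j[x_j] ∈ es, x_j = x_i
-- (the x's being binders of the let).
data Reach {k n} (es : Vec (Term (k + n)) k) (i : Fin k) : Term (k + n) → Set where
  here  : ∀ {e} (As : List (Term (k + n))) → e ≡ plugA (var (i ↑ˡ n)) As → Reach es i e
  there : ∀ {e} (j : Fin k) (As : List (Term (k + n))) → e ≡ plugA (var (j ↑ˡ n)) As
        → Reach es i (lookup es j) → Reach es i e

-- VarReach es i e : e = x₁, x₁ = x₂, …, x_{j-1} = x_j ∈ es, x_j = x_i
data VarReach {k n} (es : Vec (Term (k + n)) k) (i : Fin k) : Term (k + n) → Set where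
  here  : ∀ {e} → e ≡ var (i ↑ˡ n) → VarReach es i e
  there : ∀ {e} (j : Fin k) → e ≡ var (j ↑ˡ n) → VarReach es i (lookup es j) → VarReach es i e

data Rule : Set where
  lbeta probl probr lapp llet-in llet-e cp-in cp-e : Rule

-- the rules applied inside reduction contexts R
data RootR {n} : Term n → Rule → Term n → Set where
  r-lbeta : ∀ (s : Term (suc n)) (t : Term n) → RootR (app (lam s) t) lbeta (letr 1 (wk 1 t ∷ []) s)
  r-probl : ∀ (s t : Term n) → RootR (s ⊕ t) probl s
  r-probr : ∀ (s t : Term n) → RootR (s ⊕ t) probr t
  r-lapp  : ∀ k (es : Vec (Term (k + n)) k) (s : Term (k + n)) (t : Term n)
          → RootR (app (letr k es s) t) lapp (letr k es (app s (wk k t)))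

data Step {n} : Term n → Rule → Term n → Set where
  -- R = A
  inA     : ∀ {ρ t t'} (As : List (Term n)) → RootR t ρ t'
          → Step (plugA t As) ρ (plugA t' As)
  -- R = let env in A
  inLetA  : ∀ {ρ} k (es : Vec (Term (k + n)) k) {t t'} (As : List (Term (k + n)))
          → RootR t ρ t'
          → Step (letr k es (plugA t As)) ρ (letr k es (plugA t' As))
  -- R = let env, {x_i = A_i[x_{i+1}]}_{i=1}^m, x_{m+1} = A_{m+1} in A[x_1]
  inLetCh : ∀ {ρ} k (es : Vec (Term (k + n)) k) (b : Term (k + n)) (i : Fin k)
              {t t'} (As : List (Term (k + n)))
          → lookup es i ≡ plugA t As → Reach es i b → RootR t ρ t'
          → Step (letr k es b) ρ (letr k (es [ i ]≔ plugA t' As) b)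
  -- (llet-in)  let env1 in (let env2 in s) → let env1, env2 in s
  s-llet-in : ∀ k (es : Vec (Term (k + n)) k) k' (es' : Vec (Term (k' + (k + n))) k')
                (s : Term (k' + (k + n)))
            → Step (letr k es (letr k' es' s)) llet-in
                   (letr (k' + k) (renameVec (cast (sym (+-assoc k' k n))) es'
                                    ++ renameVec (λ j → cast (sym (+-assoc k' k n)) (k' ↑ʳ j)) es)
                                  (reassoc k' k n s))
  s-llet-e : ∀ k (es : Vec (Term (k + n)) k) (b : Term (k + n)) (i : Fin k)
               k' (es' : Vec (Term (k' + (k + n))) k') (s : Term (k' + (k + n)))
           → Reach es i b → lookup es i ≡ letr k' es' s
           → Step (letr k es b) llet-e
                  (letr (k' + k) (renameVec (cast (sym (+-assoc k' k n))) es'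
                                   ++ (renameVec (λ j → cast (sym (+-assoc k' k n)) (k' ↑ʳ j)) es
                                         [ i ]≔ reassoc k' k n s))
                                 (wkOuter k' k n b))
  s-cp-in : ∀ k (es : Vec (Term (k + n)) k) (e : Term (k + n)) (As : List (Term (k + n)))
              (i : Fin k) (s : Term (suc (k + n)))
          → VarReach es i e → lookup es i ≡ lam s
          → Step (letr k es (plugA e As)) cp-in (letr k es (plugA (lam s) As))
  -- (cp-e)   (A_n ≠ [.] : the argument list is non-empty)
  s-cp-e  : ∀ k (es : Vec (Term (k + n)) k) (b : Term (k + n)) (i : Fin k)
              (e : Term (k + n)) (a : Term (k + n)) (As : List (Term (k + n)))
              (j : Fin k) (s : Term (suc (k + n)))
          → Reach es i b → lookup es i ≡ plugA e (a ∷ As)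
          → VarReach es j e → lookup es j ≡ lam s
          → Step (letr k es b) cp-e (letr k (es [ i ]≔ plugA (lam s) (a ∷ As)) b)

data WHNF {n} : Term n → Set where
  whnf-lam : ∀ (s : Term (suc n)) → WHNF (lam s)
  whnf-let : ∀ k (es : Vec (Term (k + n)) k) (s : Term (suc (k + n))) → WHNF (letr k es (lam s))

-- An evaluation of s, recorded as the list of its steps
-- (rule used, resulting expression).
Evaluation : ℕ → Set
Evaluation n = List (Rule × Term n)

data IsEval {n} : Term n → Evaluation n → Set where
  done : ∀ {s} → WHNF s → IsEval s []
  step : ∀ {s ρ s' ev} → Step s ρ s' → IsEval s' ev → IsEval s ((ρ , s') ∷ ev)

probLength : ∀ {n} → Evaluation n → ℕ
probLength []              = 0
probLength ((probl , _) ∷ ev) = suc (probLength ev)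
probLength ((probr , _) ∷ ev) = suc (probLength ev)
probLength ((_ , _) ∷ ev)  = probLength ev

half^ : ℕ → ℚ
half^ zero    = 1ℚ
half^ (suc m) = ½ *ℚ half^ m

weight : ∀ {n} → List (Evaluation n) → ℚ
weight []        = 0ℚ
weight (e ∷ evs) = half^ (probLength e) +ℚ weight evs

-- ExCv(s) ≤ ExCv(t), where ExCv(u) = Σ_{evaluations e of u} 2^{-probLength e}
-- (an unordered sum of non-negative terms, i.e. the supremum of its finite
-- partial sums, in [0,∞]): every finite partial sum for s is, up to any
-- 2^{-k}, bounded by some finite partial sum for t.
ExCv≤ : ∀ {n} → Term n → Term n → Set
ExCv≤ {n} s t =
  ∀ (F : List (Evaluation n)) → Unique F → All (IsEval s) F → ∀ (k : ℕ) →
  ∃ λ (G : List (Evaluation n)) → Unique G × All (IsEval t) G ×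
    (weight F ≤ℚ weight G +ℚ half^ k)

_≤c_ : ∀ {m} → Term m → Term m → Set
_≤c_ {m} s t = ∀ {n} (C : Ctx n m) → ExCv≤ (plug C s) (plug C t)

_∼c_ : ∀ {m} → Term m → Term m → Set
s ∼c t = (s ≤c t) × (t ≤c s)

-- Let ≈ relate two terms that differ only in that some redexes (λx.s) t of the
-- first are replaced by let x = t in s in the second; being a congruence, it
-- relates C[(λx.s) t] to C[let x = t in s] for every context C.  Standard
-- reduction is deterministic up to the choice made at ⊕, so an evaluation is
-- determined by its word of ⊕-choices, whose length fixes its weight.  The
-- relation ≈ is a simulation in both directions in which every step is answered
-- by a step with the same rule, except for lbeta: forwards, an lbeta step at a
-- replaced redex is answered by no step; backwards, the application side may
-- first have to fire replaced redexes by lbeta, only finitely often because each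
-- such step decreases its number of β-redexes.  As lbeta steps make no choice,
-- every evaluation of one side yields an evaluation of the other with the same
-- choice word, and by determinism this map is injective; so both ExCv agree.

module Submission where

open import Defs
open import Data.Bool using (Bool; true; false)
open import Data.Empty using (⊥; ⊥-elim)
open import Data.Fin using (Fin; zero; suc; _↑ˡ_; _↑ʳ_; splitAt; cast)
open import Data.Fin.Properties using (splitAt-↑ˡ; splitAt-↑ʳ; ↑ˡ-injective)
open import Data.List using (List; []; _∷_; length) renaming (_++_ to _++ˡ_)
open import Data.List.Properties using (++-identityʳ; ∷-injectiveʳ)
open import Data.List.Relation.Binary.Pointwise using (Pointwise; []; _∷_)
open import Data.List.Relation.Unary.All using (All; []; _∷_)
open import Data.List.Relation.Unary.AllPairs using ([]; _∷_)
open import Data.List.Relation.Unary.Unique.Propositional using (Unique)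
open import Data.Nat using (ℕ; suc; _+_; _<_; s≤s)
open import Data.Nat.Induction using (<-wellFounded)
open import Data.Nat.Properties using (+-assoc; +-comm; +-identityʳ; ≤-reflexive; +-monoˡ-<; +-monoʳ-<)
open import Data.Product using (∃; ∃₂; _×_; _,_; proj₂)
open import Data.Rational using (NonNegative) renaming (_+_ to _+ℚ_; _≤_ to _≤ℚ_)
import Data.Rational.Properties as ℚ
open import Data.Sum using (_⊎_; inj₁; inj₂)
open import Data.Unit using (⊤; tt)
open import Data.Vec using (Vec; []; _∷_; lookup; _[_]≔_; _++_)
open import Data.Vec.Properties using ([]≔-lookup)
open import Function using (_∘_)
open import Induction.WellFounded using (Acc; acc)
open import Relation.Nullary using (¬_)
open import Relation.Binary.PropositionalEquality

private
  variable
    n : ℕ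

spineHead : Term n → Term n
spineHead (app f a) = spineHead f
spineHead t         = t

spineArgs : Term n → List (Term n) → List (Term n)
spineArgs (app f a) rest = spineArgs f (a ∷ rest)
spineArgs t         rest = rest

spineHead-plugA : (t : Term n) (As : List (Term n)) → spineHead (plugA t As) ≡ spineHead t
spineHead-plugA t []       = refl
spineHead-plugA t (a ∷ As) = spineHead-plugA (app t a) As

spineArgs-plugA : (t : Term n) (As rest : List (Term n)) →
                  spineArgs (plugA t As) rest ≡ spineArgs t (As ++ˡ rest)
spineArgs-plugA t []       rest = refl
spineArgs-plugA t (a ∷ As) rest = spineArgs-plugA (app t a) As rest

plugA-++ : (t : Term n) (Bs As : List (Term n)) → plugA (plugA t Bs) As ≡ plugA t (Bs ++ˡ As)
plugA-++ t []       As = refl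
plugA-++ t (b ∷ Bs) As = plugA-++ (app t b) Bs As

data NotApp {n} : Term n → Set where
  var  : ∀ i → NotApp (var i)
  lam  : ∀ s → NotApp (lam s)
  _⊕_  : ∀ s t → NotApp (s ⊕ t)
  letr : ∀ k es b → NotApp (letr k es b)

spineHead-NotApp : {h : Term n} → NotApp h → spineHead h ≡ h
spineHead-NotApp (var i)       = refl
spineHead-NotApp (lam s)       = refl
spineHead-NotApp (s ⊕ t)       = refl
spineHead-NotApp (letr k es b) = refl

spineArgs-NotApp : {h : Term n} (rest : List (Term n)) → NotApp h → spineArgs h rest ≡ rest
spineArgs-NotApp rest (var i)       = refl
spineArgs-NotApp rest (lam s)       = refl
spineArgs-NotApp rest (s ⊕ t)       = refl
spineArgs-NotApp rest (letr k es b) = refl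

plugA-injective : {h h' : Term n} (As As' : List (Term n)) → NotApp h → NotApp h' →
                  plugA h As ≡ plugA h' As' → h ≡ h' × As ≡ As'
plugA-injective {h = h} {h'} As As' nh nh' eq = heads , arguments
  where
  open ≡-Reasoning
  heads : h ≡ h'
  heads = begin
    h                        ≡⟨ sym (spineHead-NotApp nh) ⟩
    spineHead h              ≡⟨ sym (spineHead-plugA h As) ⟩
    spineHead (plugA h As)   ≡⟨ cong spineHead eq ⟩
    spineHead (plugA h' As') ≡⟨ spineHead-plugA h' As' ⟩
    spineHead h'             ≡⟨ spineHead-NotApp nh' ⟩
    h'                       ∎
  arguments : As ≡ As'
  arguments = begin
    As                          ≡⟨ sym (++-identityʳ As) ⟩
    As ++ˡ []                   ≡⟨ sym (spineArgs-NotApp _ nh) ⟩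
    spineArgs h (As ++ˡ [])     ≡⟨ sym (spineArgs-plugA h As []) ⟩
    spineArgs (plugA h As) []   ≡⟨ cong (λ x → spineArgs x []) eq ⟩
    spineArgs (plugA h' As') [] ≡⟨ spineArgs-plugA h' As' [] ⟩
    spineArgs h' (As' ++ˡ [])   ≡⟨ spineArgs-NotApp _ nh' ⟩
    As' ++ˡ []                  ≡⟨ ++-identityʳ As' ⟩
    As'                         ∎

plugA-var-injective : {x y : Fin n} (As Bs : List (Term n)) →
                      plugA (var x) As ≡ plugA (var y) Bs → x ≡ y
plugA-var-injective As Bs eq with plugA-injective As Bs (var _) (var _) eq
... | refl , _ = refl

IsVar : Term n → Set
IsVar (var _) = ⊤
IsVar _       = ⊥

IsLam : Term n → Set
IsLam (lam _) = ⊤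
IsLam _       = ⊥

VarOrLam : Term n → Set
VarOrLam (var _) = ⊤
VarOrLam (lam _) = ⊤
VarOrLam _       = ⊥

AppOr : Term n → Set
AppOr (app _ _) = ⊤
AppOr (_ ⊕ _)   = ⊤
AppOr _         = ⊥

VarHeaded : Term n → Set
VarHeaded t = IsVar (spineHead t)

AppOr-¬VarOrLam : {x : Term n} → AppOr x → ¬ VarOrLam x
AppOr-¬VarOrLam {x = app _ _} _ ()
AppOr-¬VarOrLam {x = _ ⊕ _}   _ ()

AppOr-¬IsLam : {x : Term n} → AppOr x → ¬ IsLam x
AppOr-¬IsLam {x = app _ _} _ ()
AppOr-¬IsLam {x = _ ⊕ _}   _ ()

AppOr-plugA : {t : Term n} → AppOr t → (As : List (Term n)) → AppOr (plugA t As)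
AppOr-plugA at []       = at
AppOr-plugA at (a ∷ As) = AppOr-plugA {t = app _ a} tt As

VarHeaded-plugA : {t : Term n} (As : List (Term n)) → VarHeaded t → VarHeaded (plugA t As)
VarHeaded-plugA {t = t} As = subst IsVar (sym (spineHead-plugA t As))

VarHeaded-plugA⁻ : {t : Term n} (As : List (Term n)) → VarHeaded (plugA t As) → VarHeaded t
VarHeaded-plugA⁻ {t = t} As = subst IsVar (spineHead-plugA t As)

letr-¬VarHeaded : ∀ {x : Term n} {k es b} → x ≡ letr k es b → ¬ VarHeaded x
letr-¬VarHeaded refl ()

data Redex {n} : Term n → Set where
  ⊕-redex    : ∀ s u → Redex (s ⊕ u)
  β-redex    : ∀ s u → Redex (app (lam s) u)
  lapp-redex : ∀ k es b u → Redex (app (letr k es b) u)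

RootR-Redex : ∀ {t t' : Term n} {ρ} → RootR t ρ t' → Redex t
RootR-Redex (r-lbeta s u)     = β-redex s u
RootR-Redex (r-probl s u)     = ⊕-redex s u
RootR-Redex (r-probr s u)     = ⊕-redex s u
RootR-Redex (r-lapp k es s u) = lapp-redex k es s u

Redex-AppOr : {t : Term n} → Redex t → AppOr t
Redex-AppOr (⊕-redex _ _)        = tt
Redex-AppOr (β-redex _ _)        = tt
Redex-AppOr (lapp-redex _ _ _ _) = tt

Redex-¬VarHeaded : {t : Term n} → Redex t → ∀ As → ¬ VarHeaded (plugA t As)
Redex-¬VarHeaded (⊕-redex _ _)        As = VarHeaded-plugA⁻ As
Redex-¬VarHeaded (β-redex _ _)        As = VarHeaded-plugA⁻ As
Redex-¬VarHeaded (lapp-redex _ _ _ _) As = VarHeaded-plugA⁻ As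

Redex-unique : {t t' : Term n} → Redex t → Redex t' → (As As' : List (Term n)) →
               plugA t As ≡ plugA t' As' → t ≡ t' × As ≡ As'
Redex-unique (⊕-redex s u) (⊕-redex s' u') As As' eq
  with refl , refl ← plugA-injective As As' (s ⊕ u) (s' ⊕ u') eq = refl , refl
Redex-unique (⊕-redex s u) (β-redex s' u') As As' eq
  with () ← plugA-injective As (u' ∷ As') (s ⊕ u) (lam s') eq
Redex-unique (⊕-redex s u) (lapp-redex k' es' b' u') As As' eq
  with () ← plugA-injective As (u' ∷ As') (s ⊕ u) (letr k' es' b') eq
Redex-unique (β-redex s u) (⊕-redex s' u') As As' eq
  with () ← plugA-injective (u ∷ As) As' (lam s) (s' ⊕ u') eq
Redex-unique (β-redex s u) (β-redex s' u') As As' eq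
  with refl , refl ← plugA-injective (u ∷ As) (u' ∷ As') (lam s) (lam s') eq = refl , refl
Redex-unique (β-redex s u) (lapp-redex k' es' b' u') As As' eq
  with () ← plugA-injective (u ∷ As) (u' ∷ As') (lam s) (letr k' es' b') eq
Redex-unique (lapp-redex k es b u) (⊕-redex s' u') As As' eq
  with () ← plugA-injective (u ∷ As) As' (letr k es b) (s' ⊕ u') eq
Redex-unique (lapp-redex k es b u) (β-redex s' u') As As' eq
  with () ← plugA-injective (u ∷ As) (u' ∷ As') (letr k es b) (lam s') eq
Redex-unique (lapp-redex k es b u) (lapp-redex k' es' b' u') As As' eq
  with refl , refl ← plugA-injective (u ∷ As) (u' ∷ As') (letr k es b) (letr k' es' b') eq = refl , refl

RootR-AppOr : ∀ {t t' : Term n} {ρ} → RootR t ρ t' → AppOr t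
RootR-AppOr = Redex-AppOr ∘ RootR-Redex

RootR-¬VarHeaded : ∀ {t t' x : Term n} {ρ} → RootR t ρ t' → ∀ As → x ≡ plugA t As → ¬ VarHeaded x
RootR-¬VarHeaded r As refl = Redex-¬VarHeaded (RootR-Redex r) As

plugA-RootR-≢-letr : ∀ {t t' : Term n} {ρ} → RootR t ρ t' → ∀ As {k es b} → plugA t As ≢ letr k es b
plugA-RootR-≢-letr r As eq = subst AppOr eq (AppOr-plugA (RootR-AppOr r) As)

module _ {k n : ℕ} {es : Vec (Term (k + n)) k} where

  binder-injective : ∀ {i j : Fin k} As Bs →
                     plugA (var (i ↑ˡ n)) As ≡ plugA (var (j ↑ˡ n)) Bs → i ≡ j
  binder-injective As Bs eq = ↑ˡ-injective n _ _ (plugA-var-injective As Bs eq)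

  Reach-VarHeaded : ∀ {i e} → Reach es i e → VarHeaded e
  Reach-VarHeaded (here As refl)      = VarHeaded-plugA As tt
  Reach-VarHeaded (there j As refl r) = VarHeaded-plugA As tt

  Reach-plugA : ∀ {i e} → Reach es i e → ∀ Cs → Reach es i (plugA e Cs)
  Reach-plugA (here As refl)      Cs = here (As ++ˡ Cs) (plugA-++ _ As Cs)
  Reach-plugA (there j As refl r) Cs = there j (As ++ˡ Cs) (plugA-++ _ As Cs) r

  Reach-unplugA : ∀ {i} {x : Fin (k + n)} Cs → Reach es i (plugA (var x) Cs) → Reach es i (var x)
  Reach-unplugA Cs (here As eq)      = here [] (cong var (plugA-var-injective Cs As eq))
  Reach-unplugA Cs (there j As eq r) = there j [] (cong var (plugA-var-injective Cs As eq)) r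

  Reach-trans : ∀ {i j e} → Reach es i e → Reach es j (lookup es i) → Reach es j e
  Reach-trans (here As eq)      r' = there _ As eq r'
  Reach-trans (there j As eq r) r' = there j As eq (Reach-trans r r')

  Reach-comparable : ∀ {i i' e} → Reach es i e → Reach es i' e →
                     i ≡ i' ⊎ Reach es i' (lookup es i) ⊎ Reach es i (lookup es i')
  Reach-comparable (here As eq) (here As' eq') = inj₁ (binder-injective As As' (trans (sym eq) eq'))
  Reach-comparable (here As eq) (there j As' eq' r')
    with refl ← binder-injective As As' (trans (sym eq) eq') = inj₂ (inj₁ r')
  Reach-comparable (there j As eq r) (here As' eq')
    with refl ← binder-injective As As' (trans (sym eq) eq') = inj₂ (inj₂ r)
  Reach-comparable (there j As eq r) (there j' As' eq' r')
    with refl ← binder-injective As As' (trans (sym eq) eq') = Reach-comparable r r'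

  -- Chains can only be continued through variable-headed bindings.
  Reach-functional : ∀ {i i' e} → Reach es i e → Reach es i' e →
                     ¬ VarHeaded (lookup es i) → ¬ VarHeaded (lookup es i') → i ≡ i'
  Reach-functional r r' nv nv' with Reach-comparable r r'
  ... | inj₁ eq        = eq
  ... | inj₂ (inj₁ r″) = ⊥-elim (nv (Reach-VarHeaded r″))
  ... | inj₂ (inj₂ r″) = ⊥-elim (nv' (Reach-VarHeaded r″))

  VarReach-var : ∀ {j e} → VarReach es j e → ∃ λ x → e ≡ var x
  VarReach-var (here eq)      = _ , eq
  VarReach-var (there j eq v) = _ , eq

  VarReach-IsVar : ∀ {j e} → VarReach es j e → IsVar e
  VarReach-IsVar v with _ , refl ← VarReach-var v = tt

  VarReach⇒Reach : ∀ {j e} → VarReach es j e → Reach es j e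
  VarReach⇒Reach (here eq)      = here [] eq
  VarReach⇒Reach (there j eq v) = there j [] eq (VarReach⇒Reach v)

  VarReach-VarHeaded-plugA : ∀ {j e} → VarReach es j e → ∀ Bs → VarHeaded (plugA e Bs)
  VarReach-VarHeaded-plugA v Bs with _ , refl ← VarReach-var v = VarHeaded-plugA Bs tt

  VarReach-Reach : ∀ {i j e s} → VarReach es j e → lookup es j ≡ lam s → Reach es i e →
                   (∃ λ x → lookup es i ≡ var x) ⊎ i ≡ j
  VarReach-Reach (here eq) lj (here As eq') = inj₂ (binder-injective As [] (trans (sym eq') eq))
  VarReach-Reach (here eq) lj (there j' As eq' r)
    with refl ← binder-injective As [] (trans (sym eq') eq) = ⊥-elim (subst VarHeaded lj (Reach-VarHeaded r))
  VarReach-Reach (there j' eq v) lj (here As eq')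
    with refl ← binder-injective As [] (trans (sym eq') eq) = inj₁ (VarReach-var v)
  VarReach-Reach (there j' eq v) lj (there j″ As eq' r)
    with refl ← binder-injective As [] (trans (sym eq') eq) = VarReach-Reach v lj r

  VarReach-functional : ∀ {j j' e s s'} → VarReach es j e → VarReach es j' e →
                        lookup es j ≡ lam s → lookup es j' ≡ lam s' → j ≡ j'
  VarReach-functional (here eq) (here eq') _ _ = binder-injective [] [] (trans (sym eq) eq')
  VarReach-functional (here eq) (there _ eq' v) lj _
    with refl ← binder-injective [] [] (trans (sym eq) eq') = ⊥-elim (subst IsVar lj (VarReach-IsVar v))
  VarReach-functional (there _ eq v) (here eq') _ lj'
    with refl ← binder-injective [] [] (trans (sym eq) eq') = ⊥-elim (subst IsVar lj' (VarReach-IsVar v))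
  VarReach-functional (there _ eq v) (there _ eq' v') lj lj'
    with refl ← binder-injective [] [] (trans (sym eq) eq') = VarReach-functional v v' lj lj'

  Reach-VarReach-VarOrLam : ∀ {i j e b s} Cs → Reach es i b → b ≡ plugA e Cs →
                            VarReach es j e → lookup es j ≡ lam s → VarOrLam (lookup es i)
  Reach-VarReach-VarOrLam Cs r refl v lj with _ , refl ← VarReach-var v
    with VarReach-Reach v lj (Reach-unplugA Cs r)
  ... | inj₁ (_ , eq) = subst VarOrLam (sym eq) tt
  ... | inj₂ refl     = subst VarOrLam (sym lj) tt

  -- The chain through the binding rewritten by (cp-e) continues to the copied
  -- abstraction, which is therefore the end of every chain from b.
  Reach-cp-e-end : ∀ {i i' j e a As s b} → Reach es i b → ¬ VarHeaded (lookup es i) →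
                   Reach es i' b → lookup es i' ≡ plugA e (a ∷ As) →
                   VarReach es j e → lookup es j ≡ lam s → lookup es i ≡ lam s
  Reach-cp-e-end {j = j} {a = a} {As} r nv r' lk' v lj
    with refl ← Reach-functional r
                  (Reach-trans r' (subst (Reach es j) (sym lk') (Reach-plugA (VarReach⇒Reach v) (a ∷ As))))
                  nv (subst VarHeaded lj) = lj

Agree : Rule → Term n → Rule → Term n → Set
Agree ρ a ρ' b = (ρ ≡ ρ' × a ≡ b) ⊎ (ρ ≡ probl × ρ' ≡ probr) ⊎ (ρ ≡ probr × ρ' ≡ probl)

Agree-map : ∀ {m} (f : Term m → Term n) {ρ ρ' a b} → Agree ρ a ρ' b → Agree ρ (f a) ρ' (f b)
Agree-map f (inj₁ (refl , refl)) = inj₁ (refl , refl)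
Agree-map f (inj₂ different)     = inj₂ different

Agree-sym : ∀ {ρ ρ'} {a b : Term n} → Agree ρ a ρ' b → Agree ρ' b ρ a
Agree-sym (inj₁ (refl , refl))       = inj₁ (refl , refl)
Agree-sym (inj₂ (inj₁ (eq , eq')))   = inj₂ (inj₂ (eq' , eq))
Agree-sym (inj₂ (inj₂ (eq , eq')))   = inj₂ (inj₁ (eq' , eq))

RootR-agree : ∀ {t t₁ t₂ : Term n} {ρ ρ'} → RootR t ρ t₁ → RootR t ρ' t₂ → Agree ρ t₁ ρ' t₂
RootR-agree (r-lbeta s u)     (r-lbeta .s .u)        = inj₁ (refl , refl)
RootR-agree (r-probl s u)     (r-probl .s .u)        = inj₁ (refl , refl)
RootR-agree (r-probl s u)     (r-probr .s .u)        = inj₂ (inj₁ (refl , refl))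
RootR-agree (r-probr s u)     (r-probl .s .u)        = inj₂ (inj₂ (refl , refl))
RootR-agree (r-probr s u)     (r-probr .s .u)        = inj₁ (refl , refl)
RootR-agree (r-lapp k es s u) (r-lapp .k .es .s .u)  = inj₁ (refl , refl)

llet-in-result : ∀ k (es : Vec (Term (k + n)) k) k' (es' : Vec (Term (k' + (k + n))) k')
                 (s : Term (k' + (k + n))) → Term n
llet-in-result {n} k es k' es' s =
  letr (k' + k) (renameVec (cast (sym (+-assoc k' k n))) es'
                  ++ renameVec (λ j → cast (sym (+-assoc k' k n)) (k' ↑ʳ j)) es)
                (reassoc k' k n s)

llet-e-result : ∀ k (es : Vec (Term (k + n)) k) (b : Term (k + n)) (i : Fin k)
                k' (es' : Vec (Term (k' + (k + n))) k') (s : Term (k' + (k + n))) → Term n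
llet-e-result {n} k es b i k' es' s =
  letr (k' + k) (renameVec (cast (sym (+-assoc k' k n))) es'
                  ++ (renameVec (λ j → cast (sym (+-assoc k' k n)) (k' ↑ʳ j)) es
                        [ i ]≔ reassoc k' k n s))
                (wkOuter k' k n b)

data StepKind : Set where
  kA kLetA kLetCh kLletIn kLletE kCpIn kCpE : StepKind

-- Step with its indices turned into equations, so that two steps of the same
-- term can be matched against each other; the index records the Step constructor.
data StepView {n} (s : Term n) (ρ : Rule) (s' : Term n) : StepKind → Set where
  vA      : ∀ {t t'} (As : List (Term n)) → RootR t ρ t' → s ≡ plugA t As → s' ≡ plugA t' As →
            StepView s ρ s' kA
  vLetA   : ∀ k (es : Vec (Term (k + n)) k) b {t t'} As → RootR t ρ t' → b ≡ plugA t As →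
            s ≡ letr k es b → s' ≡ letr k es (plugA t' As) → StepView s ρ s' kLetA
  vLetCh  : ∀ k (es : Vec (Term (k + n)) k) b (i : Fin k) {t t'} As → lookup es i ≡ plugA t As →
            Reach es i b → RootR t ρ t' → s ≡ letr k es b → s' ≡ letr k (es [ i ]≔ plugA t' As) b →
            StepView s ρ s' kLetCh
  vLletIn : ∀ k (es : Vec (Term (k + n)) k) k' es' s₀ → ρ ≡ llet-in → s ≡ letr k es (letr k' es' s₀) →
            s' ≡ llet-in-result k es k' es' s₀ → StepView s ρ s' kLletIn
  vLletE  : ∀ k (es : Vec (Term (k + n)) k) b i k' es' s₀ → Reach es i b → lookup es i ≡ letr k' es' s₀ →
            ρ ≡ llet-e → s ≡ letr k es b → s' ≡ llet-e-result k es b i k' es' s₀ → StepView s ρ s' kLletE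
  vCpIn   : ∀ k (es : Vec (Term (k + n)) k) b e As i s₀ → b ≡ plugA e As → VarReach es i e →
            lookup es i ≡ lam s₀ → ρ ≡ cp-in → s ≡ letr k es b → s' ≡ letr k es (plugA (lam s₀) As) →
            StepView s ρ s' kCpIn
  vCpE    : ∀ k (es : Vec (Term (k + n)) k) b i e a As j s₀ → Reach es i b →
            lookup es i ≡ plugA e (a ∷ As) → VarReach es j e → lookup es j ≡ lam s₀ → ρ ≡ cp-e →
            s ≡ letr k es b → s' ≡ letr k (es [ i ]≔ plugA (lam s₀) (a ∷ As)) b → StepView s ρ s' kCpE

view : ∀ {s s' : Term n} {ρ} → Step s ρ s' → ∃ (StepView s ρ s')
view (inA As r)                         = _ , vA As r refl refl
view (inLetA k es As r)                 = _ , vLetA k es _ As r refl refl refl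
view (inLetCh k es b i As lk rc r)      = _ , vLetCh k es b i As lk rc r refl refl
view (s-llet-in k es k' es' s)          = _ , vLletIn k es k' es' s refl refl refl
view (s-llet-e k es b i k' es' s rc lk) = _ , vLletE k es b i k' es' s rc lk refl refl refl
view (s-cp-in k es e As i s v lk)       = _ , vCpIn k es _ e As i s refl v lk refl refl refl
view (s-cp-e k es b i e a As j s rc lk v lj) = _ , vCpE k es b i e a As j s rc lk v lj refl refl refl

RootR-AppOr-plugA : ∀ {t t' : Term n} {ρ} → RootR t ρ t' → ∀ As → AppOr (plugA t As)
RootR-AppOr-plugA r = AppOr-plugA (RootR-AppOr r)

app-AppOr-plugA : (f a : Term n) (As : List (Term n)) → AppOr (plugA (app f a) As)
app-AppOr-plugA f a = AppOr-plugA tt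

AgreeFrom : StepKind → Set
AgreeFrom κ₀ = ∀ {n κ} {s s₁ s₂ : Term n} {ρ ρ'} →
               StepView s ρ s₁ κ₀ → StepView s ρ' s₂ κ → Agree ρ s₁ ρ' s₂

agree-A : AgreeFrom kA
agree-A (vA As r refl refl) (vA As' r' e₂ refl)
  with refl , refl ← Redex-unique (RootR-Redex r) (RootR-Redex r') As As' e₂
  = Agree-map (λ x → plugA x As) (RootR-agree r r')
agree-A (vA As r refl _) (vLetA _ _ _ _ _ _ e₂ _)                = ⊥-elim (plugA-RootR-≢-letr r As e₂)
agree-A (vA As r refl _) (vLetCh _ _ _ _ _ _ _ _ e₂ _)           = ⊥-elim (plugA-RootR-≢-letr r As e₂)
agree-A (vA As r refl _) (vLletIn _ _ _ _ _ _ e₂ _)              = ⊥-elim (plugA-RootR-≢-letr r As e₂)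
agree-A (vA As r refl _) (vLletE _ _ _ _ _ _ _ _ _ _ e₂ _)       = ⊥-elim (plugA-RootR-≢-letr r As e₂)
agree-A (vA As r refl _) (vCpIn _ _ _ _ _ _ _ _ _ _ _ e₂ _)      = ⊥-elim (plugA-RootR-≢-letr r As e₂)
agree-A (vA As r refl _) (vCpE _ _ _ _ _ _ _ _ _ _ _ _ _ _ e₂ _) = ⊥-elim (plugA-RootR-≢-letr r As e₂)

agree-LetA : AgreeFrom kLetA
agree-LetA {κ = kA} v v' = Agree-sym (agree-A v' v)
agree-LetA (vLetA k es b As r be refl refl) (vLetA _ _ _ As' r' be' refl refl)
  with refl , refl ← Redex-unique (RootR-Redex r) (RootR-Redex r') As As' (trans (sym be) be')
  = Agree-map (λ x → letr k es (plugA x As)) (RootR-agree r r')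
agree-LetA (vLetA _ _ _ As r be refl _) (vLetCh _ _ _ _ _ _ rc _ refl _) =
  ⊥-elim (RootR-¬VarHeaded r As be (Reach-VarHeaded rc))
agree-LetA (vLetA _ _ _ As r be refl _) (vLletIn _ _ _ _ _ _ refl _) =
  ⊥-elim (plugA-RootR-≢-letr r As (sym be))
agree-LetA (vLetA _ _ _ As r be refl _) (vLletE _ _ _ _ _ _ _ rc _ _ refl _) =
  ⊥-elim (RootR-¬VarHeaded r As be (Reach-VarHeaded rc))
agree-LetA (vLetA _ _ _ As r be refl _) (vCpIn _ _ _ _ Bs _ _ be' v _ _ refl _) =
  ⊥-elim (RootR-¬VarHeaded r As (trans (sym be') be) (VarReach-VarHeaded-plugA v Bs))
agree-LetA (vLetA _ _ _ As r be refl _) (vCpE _ _ _ _ _ _ _ _ _ rc _ _ _ _ refl _) =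
  ⊥-elim (RootR-¬VarHeaded r As be (Reach-VarHeaded rc))

agree-LetCh : AgreeFrom kLetCh
agree-LetCh {κ = kA}    v v' = Agree-sym (agree-A v' v)
agree-LetCh {κ = kLetA} v v' = Agree-sym (agree-LetA v' v)
agree-LetCh (vLetCh k es b i As lk rc r refl refl) (vLetCh _ _ _ i' As' lk' rc' r' refl refl)
  with refl ← Reach-functional rc rc' (RootR-¬VarHeaded r As lk) (RootR-¬VarHeaded r' As' lk')
  with refl , refl ← Redex-unique (RootR-Redex r) (RootR-Redex r') As As' (trans (sym lk) lk')
  = Agree-map (λ x → letr k (es [ i ]≔ plugA x As) b) (RootR-agree r r')
agree-LetCh (vLetCh _ _ _ _ _ _ rc _ refl _) (vLletIn _ _ _ _ _ _ refl _) = ⊥-elim (Reach-VarHeaded rc)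
agree-LetCh (vLetCh _ _ _ _ As lk rc r refl _) (vLletE _ _ _ _ _ _ _ rc' lk' _ refl _)
  with refl ← Reach-functional rc rc' (RootR-¬VarHeaded r As lk) (letr-¬VarHeaded lk')
  = ⊥-elim (plugA-RootR-≢-letr r As (trans (sym lk) lk'))
agree-LetCh (vLetCh _ _ _ _ As lk rc r refl _) (vCpIn _ _ _ _ Bs _ _ be' v lj _ refl _) =
  ⊥-elim (AppOr-¬VarOrLam (subst AppOr (sym lk) (RootR-AppOr-plugA r As))
                          (Reach-VarReach-VarOrLam Bs rc be' v lj))
agree-LetCh (vLetCh _ _ _ _ As lk rc r refl _) (vCpE _ _ _ _ _ a' As' _ _ rc' lk' v lj _ refl _) =
  ⊥-elim (subst AppOr (trans (sym lk) (Reach-cp-e-end {a = a'} {As = As'} rc (RootR-¬VarHeaded r As lk)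
                                                      rc' lk' v lj))
                (RootR-AppOr-plugA r As))

agree-LletIn : AgreeFrom kLletIn
agree-LletIn {κ = kA}     v v' = Agree-sym (agree-A v' v)
agree-LletIn {κ = kLetA}  v v' = Agree-sym (agree-LetA v' v)
agree-LletIn {κ = kLetCh} v v' = Agree-sym (agree-LetCh v' v)
agree-LletIn (vLletIn _ _ _ _ _ refl refl refl) (vLletIn _ _ _ _ _ refl refl refl) = inj₁ (refl , refl)
agree-LletIn (vLletIn _ _ _ _ _ _ refl _) (vLletE _ _ _ _ _ _ _ rc _ _ refl _) = ⊥-elim (Reach-VarHeaded rc)
agree-LletIn (vLletIn _ _ _ _ _ _ refl _) (vCpIn _ _ _ _ Bs _ _ be' v _ _ refl _) =
  ⊥-elim (subst VarHeaded (sym be') (VarReach-VarHeaded-plugA v Bs))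
agree-LletIn (vLletIn _ _ _ _ _ _ refl _) (vCpE _ _ _ _ _ _ _ _ _ rc _ _ _ _ refl _) =
  ⊥-elim (Reach-VarHeaded rc)

agree-LletE : AgreeFrom kLletE
agree-LletE {κ = kA}      v v' = Agree-sym (agree-A v' v)
agree-LletE {κ = kLetA}   v v' = Agree-sym (agree-LetA v' v)
agree-LletE {κ = kLetCh}  v v' = Agree-sym (agree-LetCh v' v)
agree-LletE {κ = kLletIn} v v' = Agree-sym (agree-LletIn v' v)
agree-LletE (vLletE _ _ _ _ _ _ _ rc lk refl refl refl) (vLletE _ _ _ _ _ _ _ rc' lk' refl refl refl)
  with refl ← Reach-functional rc rc' (letr-¬VarHeaded lk) (letr-¬VarHeaded lk')
  with refl ← trans (sym lk) lk' = inj₁ (refl , refl)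
agree-LletE (vLletE _ _ _ _ _ _ _ rc lk _ refl _) (vCpIn _ _ _ _ Bs _ _ be' v lj _ refl _) =
  ⊥-elim (subst VarOrLam lk (Reach-VarReach-VarOrLam Bs rc be' v lj))
agree-LletE (vLletE _ _ _ _ _ _ _ rc lk _ refl _) (vCpE _ _ _ _ _ a' As' _ _ rc' lk' v lj _ refl _)
  with () ← trans (sym lk) (Reach-cp-e-end {a = a'} {As = As'} rc (letr-¬VarHeaded lk) rc' lk' v lj)

agree-CpIn : AgreeFrom kCpIn
agree-CpIn {κ = kA}      v v' = Agree-sym (agree-A v' v)
agree-CpIn {κ = kLetA}   v v' = Agree-sym (agree-LetA v' v)
agree-CpIn {κ = kLetCh}  v v' = Agree-sym (agree-LetCh v' v)
agree-CpIn {κ = kLletIn} v v' = Agree-sym (agree-LletIn v' v)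
agree-CpIn {κ = kLletE}  v v' = Agree-sym (agree-LletE v' v)
agree-CpIn (vCpIn _ _ _ _ As _ _ be v lj refl refl refl) (vCpIn _ _ _ _ As' _ _ be' v' lj' refl refl refl)
  with x , refl ← VarReach-var v
  with x' , refl ← VarReach-var v'
  with refl , refl ← plugA-injective As As' (var x) (var x') (trans (sym be) be')
  with refl ← VarReach-functional v v' lj lj'
  with refl ← trans (sym lj) lj' = inj₁ (refl , refl)
agree-CpIn (vCpIn _ _ _ _ As _ _ be v lj _ refl _) (vCpE _ _ _ _ e' a' As' _ _ rc' lk' _ _ _ refl _) =
  ⊥-elim (AppOr-¬VarOrLam (subst AppOr (sym lk') (app-AppOr-plugA e' a' As'))
                          (Reach-VarReach-VarOrLam As rc' be v lj))

agree-CpE : AgreeFrom kCpE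
agree-CpE {κ = kA}      v v' = Agree-sym (agree-A v' v)
agree-CpE {κ = kLetA}   v v' = Agree-sym (agree-LetA v' v)
agree-CpE {κ = kLetCh}  v v' = Agree-sym (agree-LetCh v' v)
agree-CpE {κ = kLletIn} v v' = Agree-sym (agree-LletIn v' v)
agree-CpE {κ = kLletE}  v v' = Agree-sym (agree-LletE v' v)
agree-CpE {κ = kCpIn}   v v' = Agree-sym (agree-CpIn v' v)
agree-CpE (vCpE _ es _ i e a As _ _ rc lk v lj refl refl refl)
          (vCpE _ _ _ i' e' a' As' _ _ rc' lk' v' lj' refl refl refl)
  with Reach-comparable rc rc'
... | inj₂ (inj₁ r) =
  ⊥-elim (AppOr-¬VarOrLam (subst AppOr (sym lk') (app-AppOr-plugA e' a' As'))
                          (Reach-VarReach-VarOrLam (a ∷ As) (subst (Reach es i') lk r) refl v lj))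
... | inj₂ (inj₂ r) =
  ⊥-elim (AppOr-¬VarOrLam (subst AppOr (sym lk) (app-AppOr-plugA e a As))
                          (Reach-VarReach-VarOrLam (a' ∷ As') (subst (Reach es i) lk' r) refl v' lj'))
... | inj₁ refl
  with x , refl ← VarReach-var v
  with x' , refl ← VarReach-var v'
  with refl , refl ← plugA-injective (a ∷ As) (a' ∷ As') (var x) (var x') (trans (sym lk) lk')
  with refl ← VarReach-functional v v' lj lj'
  with refl ← trans (sym lj) lj' = inj₁ (refl , refl)

agree : ∀ {κ κ'} {s s₁ s₂ : Term n} {ρ ρ'} → StepView s ρ s₁ κ → StepView s ρ' s₂ κ' → Agree ρ s₁ ρ' s₂
agree {κ = kA}      = agree-A
agree {κ = kLetA}   = agree-LetA
agree {κ = kLetCh}  = agree-LetCh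
agree {κ = kLletIn} = agree-LletIn
agree {κ = kLletE}  = agree-LletE
agree {κ = kCpIn}   = agree-CpIn
agree {κ = kCpE}    = agree-CpE

WHNF-irreducible : ∀ {κ} {s s' : Term n} {ρ} → WHNF s → ¬ StepView s ρ s' κ
WHNF-irreducible (whnf-lam _) (vA As r e _)                            = subst AppOr (sym e) (RootR-AppOr-plugA r As)
WHNF-irreducible (whnf-lam _) (vLetA _ _ _ _ _ _ () _)
WHNF-irreducible (whnf-lam _) (vLetCh _ _ _ _ _ _ _ _ () _)
WHNF-irreducible (whnf-lam _) (vLletIn _ _ _ _ _ _ () _)
WHNF-irreducible (whnf-lam _) (vLletE _ _ _ _ _ _ _ _ _ _ () _)
WHNF-irreducible (whnf-lam _) (vCpIn _ _ _ _ _ _ _ _ _ _ _ () _)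
WHNF-irreducible (whnf-lam _) (vCpE _ _ _ _ _ _ _ _ _ _ _ _ _ _ () _)
WHNF-irreducible (whnf-let _ _ _) (vA As r e _)                        = plugA-RootR-≢-letr r As (sym e)
WHNF-irreducible (whnf-let _ _ _) (vLetA _ _ _ As r be refl _)         = subst AppOr (sym be) (RootR-AppOr-plugA r As)
WHNF-irreducible (whnf-let _ _ _) (vLetCh _ _ _ _ _ _ rc _ refl _)     = Reach-VarHeaded rc
WHNF-irreducible (whnf-let _ _ _) (vLletIn _ _ _ _ _ _ () _)
WHNF-irreducible (whnf-let _ _ _) (vLletE _ _ _ _ _ _ _ rc _ _ refl _) = Reach-VarHeaded rc
WHNF-irreducible (whnf-let _ _ _) (vCpIn _ _ _ _ Bs _ _ be v _ _ refl _) =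
  subst VarHeaded (sym be) (VarReach-VarHeaded-plugA v Bs)
WHNF-irreducible (whnf-let _ _ _) (vCpE _ _ _ _ _ _ _ _ _ rc _ _ _ _ refl _) = Reach-VarHeaded rc

choice : Rule → List Bool → List Bool
choice probl w = false ∷ w
choice probr w = true ∷ w
choice _     w = w

choices : Evaluation n → List Bool
choices []             = []
choices ((ρ , _) ∷ ev) = choice ρ (choices ev)

choice-injective : ∀ ρ {w w'} → choice ρ w ≡ choice ρ w' → w ≡ w'
choice-injective lbeta   eq = eq
choice-injective probl   eq = ∷-injectiveʳ eq
choice-injective probr   eq = ∷-injectiveʳ eq
choice-injective lapp    eq = eq
choice-injective llet-in eq = eq
choice-injective llet-e  eq = eq
choice-injective cp-in   eq = eq
choice-injective cp-e    eq = eq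

probLength-choices : (ev : Evaluation n) → probLength ev ≡ length (choices ev)
probLength-choices []                  = refl
probLength-choices ((lbeta   , _) ∷ ev) = probLength-choices ev
probLength-choices ((probl   , _) ∷ ev) = cong suc (probLength-choices ev)
probLength-choices ((probr   , _) ∷ ev) = cong suc (probLength-choices ev)
probLength-choices ((lapp    , _) ∷ ev) = probLength-choices ev
probLength-choices ((llet-in , _) ∷ ev) = probLength-choices ev
probLength-choices ((llet-e  , _) ∷ ev) = probLength-choices ev
probLength-choices ((cp-in   , _) ∷ ev) = probLength-choices ev
probLength-choices ((cp-e    , _) ∷ ev) = probLength-choices ev

IsEval-deterministic : ∀ {s : Term n} {ev ev'} → IsEval s ev → IsEval s ev' →
                       choices ev ≡ choices ev' → ev ≡ ev'
IsEval-deterministic (done _) (done _) _ = refl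
IsEval-deterministic (done w) (step st _) _ = ⊥-elim (WHNF-irreducible w (proj₂ (view st)))
IsEval-deterministic (step st _) (done w) _ = ⊥-elim (WHNF-irreducible w (proj₂ (view st)))
IsEval-deterministic (step {ρ = ρ} st ev) (step st' ev') eq with agree (proj₂ (view st)) (proj₂ (view st'))
... | inj₁ (refl , refl)       = cong (_ ∷_) (IsEval-deterministic ev ev' (choice-injective ρ eq))
... | inj₂ (inj₁ (refl , refl)) with () ← eq
... | inj₂ (inj₂ (refl , refl)) with () ← eq

SameChoices : Evaluation n → Evaluation n → Set
SameChoices ev ev' = choices ev ≡ choices ev'

weight-cong : {F G : List (Evaluation n)} → Pointwise SameChoices F G → weight F ≡ weight G
weight-cong [] = refl
weight-cong {F = f ∷ _} {g ∷ _} (same ∷ sames) = cong₂ _+ℚ_ (cong half^ probLengths) (weight-cong sames)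
  where
  probLengths : probLength f ≡ probLength g
  probLengths = trans (probLength-choices f) (trans (cong length same) (sym (probLength-choices g)))

module _ {s : Term n} where

  private
    all-≢-transport : ∀ {f g F G} → IsEval s f → SameChoices f g → All (IsEval s) F →
                      Pointwise SameChoices F G → All (f ≢_) F → All (g ≢_) G
    all-≢-transport _ _ [] [] [] = []
    all-≢-transport evf same (ev ∷ evs) (same' ∷ sames) (f≢ ∷ fs≢) =
      (λ g≡ → f≢ (IsEval-deterministic evf ev (trans same (trans (cong choices g≡) (sym same')))))
      ∷ all-≢-transport evf same evs sames fs≢

  Unique-transport : ∀ {F G} → All (IsEval s) F → Pointwise SameChoices F G → Unique F → Unique G
  Unique-transport [] [] [] = []
  Unique-transport (ev ∷ evs) (same ∷ sames) (f≢ ∷ unique) =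
    all-≢-transport ev same evs sames f≢ ∷ Unique-transport evs sames unique

half^-nonNegative : ∀ k → NonNegative (half^ k)
half^-nonNegative 0       = _
half^-nonNegative (suc k) = ℚ.nonNeg*nonNeg⇒nonNeg _ (half^ k) {{half^-nonNegative k}}

≤-+-half^ : ∀ p k → p ≤ℚ p +ℚ half^ k
≤-+-half^ p k = ℚ.≤-trans (ℚ.≤-reflexive (sym (ℚ.+-identityʳ p)))
                          (ℚ.+-monoʳ-≤ p (ℚ.nonNegative⁻¹ (half^ k) {{half^-nonNegative k}}))

ExCv≤-by-simulation : {s t : Term n} →
                      (∀ {ev} → IsEval s ev → ∃ λ ev' → IsEval t ev' × SameChoices ev ev') → ExCv≤ s t
ExCv≤-by-simulation {s = s} {t} simulate F unique evals k with simulateAll F evals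
  where
  simulateAll : ∀ F → All (IsEval s) F → ∃ λ G → All (IsEval t) G × Pointwise SameChoices F G
  simulateAll [] [] = [] , [] , []
  simulateAll (_ ∷ F) (ev ∷ evs) with simulate ev | simulateAll F evs
  ... | g , evg , same | G , evsG , sames = g ∷ G , evg ∷ evsG , same ∷ sames
... | G , evalsG , sames =
  G , Unique-transport evals sames unique , evalsG ,
  subst (λ w → weight F ≤ℚ w +ℚ half^ k) (weight-cong sames) (≤-+-half^ (weight F) k)

ext-cong : ∀ k {m n} {f g : Fin m → Fin n} → (∀ i → f i ≡ g i) → ∀ i → ext k f i ≡ ext k g i
ext-cong k eq i with splitAt k i
... | inj₁ j = refl
... | inj₂ j = cong (k ↑ʳ_) (eq j)

ext-∘ : ∀ k {l m n} (f : Fin m → Fin n) (g : Fin l → Fin m) i → ext k f (ext k g i) ≡ ext k (f ∘ g) i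
ext-∘ k {m = m} f g i with splitAt k i
... | inj₁ j rewrite splitAt-↑ˡ k j m = refl
... | inj₂ j rewrite splitAt-↑ʳ k m (g j) = refl

mutual
  rename-cong : ∀ {m n} {f g : Fin m → Fin n} → (∀ i → f i ≡ g i) → ∀ t → rename f t ≡ rename g t
  rename-cong eq (var i)       = cong var (eq i)
  rename-cong eq (lam s)       = cong lam (rename-cong (ext-cong 1 eq) s)
  rename-cong eq (app s t)     = cong₂ app (rename-cong eq s) (rename-cong eq t)
  rename-cong eq (s ⊕ t)       = cong₂ _⊕_ (rename-cong eq s) (rename-cong eq t)
  rename-cong eq (letr k es b) =
    cong₂ (letr k) (renameVec-cong (ext-cong k eq) es) (rename-cong (ext-cong k eq) b)

  renameVec-cong : ∀ {m n k} {f g : Fin m → Fin n} → (∀ i → f i ≡ g i) →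
                   (es : Vec (Term m) k) → renameVec f es ≡ renameVec g es
  renameVec-cong eq []       = refl
  renameVec-cong eq (e ∷ es) = cong₂ _∷_ (rename-cong eq e) (renameVec-cong eq es)

mutual
  rename-∘ : ∀ {l m n} (f : Fin m → Fin n) (g : Fin l → Fin m) t → rename f (rename g t) ≡ rename (f ∘ g) t
  rename-∘ f g (var i)       = refl
  rename-∘ f g (lam s)       = cong lam (trans (rename-∘ _ _ s) (rename-cong (ext-∘ 1 f g) s))
  rename-∘ f g (app s t)     = cong₂ app (rename-∘ f g s) (rename-∘ f g t)
  rename-∘ f g (s ⊕ t)       = cong₂ _⊕_ (rename-∘ f g s) (rename-∘ f g t)
  rename-∘ f g (letr k es b) = cong₂ (letr k) (trans (renameVec-∘ _ _ es) (renameVec-cong (ext-∘ k f g) es))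
                                              (trans (rename-∘ _ _ b) (rename-cong (ext-∘ k f g) b))

  renameVec-∘ : ∀ {l m n k} (f : Fin m → Fin n) (g : Fin l → Fin m) (es : Vec (Term l) k) →
                renameVec f (renameVec g es) ≡ renameVec (f ∘ g) es
  renameVec-∘ f g []       = refl
  renameVec-∘ f g (e ∷ es) = cong₂ _∷_ (rename-∘ f g e) (renameVec-∘ f g es)

rename-wk : ∀ {m n} (ρ : Fin m → Fin n) t → rename (ext 1 ρ) (wk 1 t) ≡ wk 1 (rename ρ t)
rename-wk ρ t = trans (rename-∘ (ext 1 ρ) (1 ↑ʳ_) t) (sym (rename-∘ (1 ↑ʳ_) ρ t))

infix 4 _≈_ _≈v_ _≈l_

mutual
  data _≈_ : ∀ {n} → Term n → Term n → Set where
    ≈var  : ∀ {n} (i : Fin n) → var i ≈ var i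
    ≈lam  : ∀ {n} {s s' : Term (suc n)} → s ≈ s' → lam s ≈ lam s'
    ≈app  : ∀ {n} {s s' t t' : Term n} → s ≈ s' → t ≈ t' → app s t ≈ app s' t'
    ≈or   : ∀ {n} {s s' t t' : Term n} → s ≈ s' → t ≈ t' → s ⊕ t ≈ s' ⊕ t'
    ≈let  : ∀ {n} k {es es' : Vec (Term (k + n)) k} {b b'} → es ≈v es' → b ≈ b' → letr k es b ≈ letr k es' b'
    ≈beta : ∀ {n} {s s' : Term (suc n)} {t t' : Term n} → s ≈ s' → t ≈ t' →
            app (lam s) t ≈ letr 1 (wk 1 t' ∷ []) s'

  data _≈v_ : ∀ {n k} → Vec (Term n) k → Vec (Term n) k → Set where
    []  : ∀ {n} → _≈v_ {n} [] []
    _∷_ : ∀ {n k} {e e' : Term n} {es es' : Vec (Term n) k} → e ≈ e' → es ≈v es' → (e ∷ es) ≈v (e' ∷ es')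

data _≈l_ {n} : List (Term n) → List (Term n) → Set where
  []  : [] ≈l []
  _∷_ : ∀ {a a' As As'} → a ≈ a' → As ≈l As' → (a ∷ As) ≈l (a' ∷ As')

mutual
  ≈-refl : (t : Term n) → t ≈ t
  ≈-refl (var i)       = ≈var i
  ≈-refl (lam s)       = ≈lam (≈-refl s)
  ≈-refl (app s t)     = ≈app (≈-refl s) (≈-refl t)
  ≈-refl (s ⊕ t)       = ≈or (≈-refl s) (≈-refl t)
  ≈-refl (letr k es b) = ≈let k (≈v-refl es) (≈-refl b)

  ≈v-refl : ∀ {k} (es : Vec (Term n) k) → es ≈v es
  ≈v-refl []       = []
  ≈v-refl (e ∷ es) = ≈-refl e ∷ ≈v-refl es

mutual
  ≈-rename : ∀ {m n} (ρ : Fin m → Fin n) {s s'} → s ≈ s' → rename ρ s ≈ rename ρ s'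
  ≈-rename ρ (≈var i)      = ≈var (ρ i)
  ≈-rename ρ (≈lam r)      = ≈lam (≈-rename _ r)
  ≈-rename ρ (≈app r r')   = ≈app (≈-rename ρ r) (≈-rename ρ r')
  ≈-rename ρ (≈or r r')    = ≈or (≈-rename ρ r) (≈-rename ρ r')
  ≈-rename ρ (≈let k rs r) = ≈let k (≈v-rename _ rs) (≈-rename _ r)
  ≈-rename ρ (≈beta {t' = t'} r r') =
    subst (λ u → _ ≈ letr 1 (u ∷ []) _) (sym (rename-wk ρ t')) (≈beta (≈-rename _ r) (≈-rename ρ r'))

  ≈v-rename : ∀ {m n k} (ρ : Fin m → Fin n) {es es' : Vec (Term m) k} → es ≈v es' →
              renameVec ρ es ≈v renameVec ρ es'
  ≈v-rename ρ []       = []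
  ≈v-rename ρ (r ∷ rs) = ≈-rename ρ r ∷ ≈v-rename ρ rs

≈v-lookup : ∀ {k} {es es' : Vec (Term n) k} → es ≈v es' → ∀ i → lookup es i ≈ lookup es' i
≈v-lookup (r ∷ rs) zero    = r
≈v-lookup (r ∷ rs) (suc i) = ≈v-lookup rs i

≈v-lookupˡ : ∀ {k} {es es' : Vec (Term n) k} {x} → es ≈v es' → ∀ i → lookup es i ≡ x → x ≈ lookup es' i
≈v-lookupˡ rs i refl = ≈v-lookup rs i

≈v-lookupʳ : ∀ {k} {es es' : Vec (Term n) k} {y} → es ≈v es' → ∀ i → lookup es' i ≡ y → lookup es i ≈ y
≈v-lookupʳ rs i refl = ≈v-lookup rs i

≈v-update : ∀ {k} {es es' : Vec (Term n) k} {x x'} → es ≈v es' → ∀ i → x ≈ x' → (es [ i ]≔ x) ≈v (es' [ i ]≔ x')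
≈v-update (r ∷ rs) zero    rx = rx ∷ rs
≈v-update (r ∷ rs) (suc i) rx = r ∷ ≈v-update rs i rx

≈v-updateˡ : ∀ {k} {es es' : Vec (Term n) k} {x} → es ≈v es' → ∀ i → x ≈ lookup es' i → (es [ i ]≔ x) ≈v es'
≈v-updateˡ {es' = es'} rs i rx = subst (_ ≈v_) ([]≔-lookup es' i) (≈v-update rs i rx)

≈v-++ : ∀ {k l} {es es' : Vec (Term n) k} {fs fs' : Vec (Term n) l} → es ≈v es' → fs ≈v fs' →
        (es ++ fs) ≈v (es' ++ fs')
≈v-++ []       qs = qs
≈v-++ (r ∷ rs) qs = r ∷ ≈v-++ rs qs

≈-plugA : {t t' : Term n} {As As' : List (Term n)} → t ≈ t' → As ≈l As' → plugA t As ≈ plugA t' As'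
≈-plugA r []       = r
≈-plugA r (a ∷ as) = ≈-plugA (≈app r a) as

≈-plug : ∀ {n m} (C : Ctx n m) {A L} → A ≈ L → plug C A ≈ plug C L
≈-plug hole                        r = r
≈-plug (lamC C)                    r = ≈lam (≈-plug C r)
≈-plug (appL C t)                  r = ≈app (≈-plug C r) (≈-refl t)
≈-plug (appR t C)                  r = ≈app (≈-refl t) (≈-plug C r)
≈-plug (orL C t)                   r = ≈or (≈-plug C r) (≈-refl t)
≈-plug (orR t C)                   r = ≈or (≈-refl t) (≈-plug C r)
≈-plug (letBody k es C)            r = ≈let k (≈v-refl es) (≈-plug C r)
≈-plug (letBind k₁ k₂ pre C post b) r =
  ≈let (k₁ + suc k₂) (≈v-++ (≈v-refl pre) (≈-plug C r ∷ ≈v-refl post)) (≈-refl b)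

lbeta-result-≈ : {s s' : Term (suc n)} {t t' : Term n} → s ≈ s' → t ≈ t' →
                 letr 1 (wk 1 t ∷ []) s ≈ letr 1 (wk 1 t' ∷ []) s'
lbeta-result-≈ rs rt = ≈let 1 (≈-rename _ rt ∷ []) rs

llet-in-result-≈ : ∀ k {es es₂ : Vec (Term (k + n)) k} k' {es' es₂' : Vec (Term (k' + (k + n))) k'} {s s₂} →
                   es ≈v es₂ → es' ≈v es₂' → s ≈ s₂ →
                   llet-in-result k es k' es' s ≈ llet-in-result k es₂ k' es₂' s₂
llet-in-result-≈ k k' r₁ r₂ r₃ = ≈let (k' + k) (≈v-++ (≈v-rename _ r₂) (≈v-rename _ r₁)) (≈-rename _ r₃)

llet-e-result-≈ : ∀ k {es es₂ : Vec (Term (k + n)) k} {b b₂} i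
                    k' {es' es₂' : Vec (Term (k' + (k + n))) k'} {s s₂} →
                  es ≈v es₂ → b ≈ b₂ → es' ≈v es₂' → s ≈ s₂ →
                  llet-e-result k es b i k' es' s ≈ llet-e-result k es₂ b₂ i k' es₂' s₂
llet-e-result-≈ k i k' r₁ rb r₂ r₃ =
  ≈let (k' + k) (≈v-++ (≈v-rename _ r₂) (≈v-update (≈v-rename _ r₁) i (≈-rename _ r₃)))
                (≈-rename _ (≈-rename _ rb))

plugA-≈-inv : (h : Term n) (As : List (Term n)) {L : Term n} → ¬ IsLam h → plugA h As ≈ L →
              ∃₂ λ h' As' → L ≡ plugA h' As' × h ≈ h' × As ≈l As'
plugA-≈-inv h [] _ r = _ , [] , refl , r , []
plugA-≈-inv h (a ∷ As) notLam r with plugA-≈-inv (app h a) As (λ ()) r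
... | _ , As' , refl , ≈app rh ra , ras = _ , _ ∷ As' , refl , rh , ra ∷ ras
... | _ , _   , refl , ≈beta _ _  , _   = ⊥-elim (notLam tt)

≈-plugA-inv : {X : Term n} (h' : Term n) (As' : List (Term n)) → X ≈ plugA h' As' →
              ∃₂ λ h As → X ≡ plugA h As × h ≈ h' × As ≈l As'
≈-plugA-inv h' [] r = _ , [] , refl , r , []
≈-plugA-inv h' (a ∷ As') r with ≈-plugA-inv (app h' a) As' r
... | _ , As , refl , ≈app rh ra , ras = _ , _ ∷ As , refl , rh , ra ∷ ras

var-≈-inv : ∀ {x : Fin n} {L} → var x ≈ L → L ≡ var x
var-≈-inv (≈var _) = refl

≈-var-inv : ∀ {x : Fin n} {A} → A ≈ var x → A ≡ var x
≈-var-inv (≈var _) = refl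

lam-≈-inv : ∀ {s : Term (suc n)} {L} → lam s ≈ L → ∃ λ s' → L ≡ lam s' × s ≈ s'
lam-≈-inv (≈lam r) = _ , refl , r

≈-lam-inv : ∀ {s' : Term (suc n)} {A} → A ≈ lam s' → ∃ λ s → A ≡ lam s × s ≈ s'
≈-lam-inv (≈lam r) = _ , refl , r

letr-≈-inv : ∀ {k} {es : Vec (Term (k + n)) k} {b L} → letr k es b ≈ L →
             ∃₂ λ es' b' → L ≡ letr k es' b' × es ≈v es' × b ≈ b'
letr-≈-inv (≈let k rs r) = _ , _ , refl , rs , r

≈-letr-inv : ∀ {k'} {x : Term n} {es' : Vec (Term (k' + n)) k'} {s} → x ≈ letr k' es' s →
             (∃₂ λ es s₀ → x ≡ letr k' es s₀ × es ≈v es' × s₀ ≈ s) ⊎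
             (∃ λ x₁ → RootR x lbeta x₁ × x₁ ≈ letr k' es' s)
≈-letr-inv (≈let k rs r)  = inj₁ (_ , _ , refl , rs , r)
≈-letr-inv (≈beta rs rt) = inj₂ (_ , r-lbeta _ _ , lbeta-result-≈ rs rt)

module _ {k n : ℕ} {es es' : Vec (Term (k + n)) k} (rs : es ≈v es') where

  Reach-≈ : ∀ {i b b'} → b ≈ b' → Reach es i b → Reach es' i b'
  Reach-≈ rb (here As refl) with _ , As' , refl , rh , _ ← plugA-≈-inv (var _) As (λ ()) rb
    rewrite var-≈-inv rh = here As' refl
  Reach-≈ rb (there j As refl r) with _ , As' , refl , rh , _ ← plugA-≈-inv (var _) As (λ ()) rb
    rewrite var-≈-inv rh = there j As' refl (Reach-≈ (≈v-lookup rs j) r)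

  Reach-≈⁻ : ∀ {i b b'} → b ≈ b' → Reach es' i b' → Reach es i b
  Reach-≈⁻ rb (here As' refl) with _ , As , refl , rh , _ ← ≈-plugA-inv (var _) As' rb
    rewrite ≈-var-inv rh = here As refl
  Reach-≈⁻ rb (there j As' refl r) with _ , As , refl , rh , _ ← ≈-plugA-inv (var _) As' rb
    rewrite ≈-var-inv rh = there j As refl (Reach-≈⁻ (≈v-lookup rs j) r)

  VarReach-≈ : ∀ {i e e'} → e ≈ e' → VarReach es i e → VarReach es' i e'
  VarReach-≈ re (here refl)      rewrite var-≈-inv re = here refl
  VarReach-≈ re (there j refl v) rewrite var-≈-inv re = there j refl (VarReach-≈ (≈v-lookup rs j) v)

  VarReach-≈⁻ : ∀ {i e e'} → e ≈ e' → VarReach es' i e' → VarReach es i e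
  VarReach-≈⁻ re (here refl)      rewrite ≈-var-inv re = here refl
  VarReach-≈⁻ re (there j refl v) rewrite ≈-var-inv re = there j refl (VarReach-≈⁻ (≈v-lookup rs j) v)

RootR-≈-forward : ∀ {t h₂ t' : Term n} {ρ} → t ≈ h₂ → RootR t ρ t' →
                  (ρ ≡ lbeta × t' ≈ h₂) ⊎ (∃ λ t₂' → RootR h₂ ρ t₂' × t' ≈ t₂')
RootR-≈-forward (≈app (≈lam rs) ru)     (r-lbeta _ _)      = inj₂ (_ , r-lbeta _ _ , lbeta-result-≈ rs ru)
RootR-≈-forward (≈beta rs ru)           (r-lbeta _ _)      = inj₁ (refl , lbeta-result-≈ rs ru)
RootR-≈-forward (≈or r₁ _)              (r-probl _ _)      = inj₂ (_ , r-probl _ _ , r₁)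
RootR-≈-forward (≈or _ r₂)              (r-probr _ _)      = inj₂ (_ , r-probr _ _ , r₂)
RootR-≈-forward (≈app (≈let k rs rb) ru) (r-lapp _ _ _ _) =
  inj₂ (_ , r-lapp _ _ _ _ , ≈let k rs (≈app rb (≈-rename _ ru)))

RootR-¬IsLam : ∀ {t t' : Term n} {ρ} → RootR t ρ t' → ¬ IsLam t
RootR-¬IsLam = AppOr-¬IsLam ∘ RootR-AppOr

WHNF-≈ : {A L : Term n} → A ≈ L → WHNF A → WHNF L
WHNF-≈ (≈lam _)            (whnf-lam _)     = whnf-lam _
WHNF-≈ (≈let k _ (≈lam _)) (whnf-let k _ _) = whnf-let k _ _

ForwardStep : Term n → Rule → Term n → Set
ForwardStep A' ρ L = (ρ ≡ lbeta × A' ≈ L) ⊎ (∃ λ L' → Step L ρ L' × A' ≈ L')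

step-forward : ∀ {κ} {A A' L : Term n} {ρ} → A ≈ L → StepView A ρ A' κ → ForwardStep A' ρ L
step-forward rel (vA As r refl refl)
  with _ , As₂ , refl , rh , ras ← plugA-≈-inv _ As (RootR-¬IsLam r) rel
  with RootR-≈-forward rh r
... | inj₁ (refl , rt)     = inj₁ (refl , ≈-plugA rt ras)
... | inj₂ (_ , r₂ , rt)   = inj₂ (_ , inA As₂ r₂ , ≈-plugA rt ras)
step-forward (≈let k rs rb) (vLetA _ _ _ As r refl refl refl)
  with _ , As₂ , refl , rh , ras ← plugA-≈-inv _ As (RootR-¬IsLam r) rb
  with RootR-≈-forward rh r
... | inj₁ (refl , rt)     = inj₁ (refl , ≈let k rs (≈-plugA rt ras))
... | inj₂ (_ , r₂ , rt)   = inj₂ (_ , inLetA k _ As₂ r₂ , ≈let k rs (≈-plugA rt ras))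
step-forward (≈let k rs rb) (vLetCh _ _ _ i As lk rc r refl refl)
  with _ , As₂ , lk₂ , rh , ras ← plugA-≈-inv _ As (RootR-¬IsLam r) (≈v-lookupˡ rs i lk)
  with RootR-≈-forward rh r
... | inj₁ (refl , rt)   = inj₁ (refl , ≈let k (≈v-updateˡ rs i (subst (_ ≈_) (sym lk₂) (≈-plugA rt ras))) rb)
... | inj₂ (_ , r₂ , rt) =
  inj₂ (_ , inLetCh k _ _ i As₂ lk₂ (Reach-≈ rs rb rc) r₂ , ≈let k (≈v-update rs i (≈-plugA rt ras)) rb)
step-forward (≈let k rs rb) (vLletIn _ _ k' _ _ refl refl refl)
  with es₂' , s₂ , refl , rs' , r₀ ← letr-≈-inv rb
  = inj₂ (_ , s-llet-in k _ k' es₂' s₂ , llet-in-result-≈ k k' rs rs' r₀)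
step-forward (≈let k rs rb) (vLletE _ _ _ i k' _ _ rc lk refl refl refl)
  with es₂' , s₂ , lk₂ , rs' , r₀ ← letr-≈-inv (≈v-lookupˡ rs i lk)
  = inj₂ (_ , s-llet-e k _ _ i k' es₂' s₂ (Reach-≈ rs rb rc) lk₂ , llet-e-result-≈ k i k' rs rb rs' r₀)
step-forward (≈let k rs rb) (vCpIn _ _ _ _ As i _ refl v lj refl refl refl)
  with x , refl ← VarReach-var v
  with _ , As₂ , refl , rh , ras ← plugA-≈-inv (var x) As (λ ()) rb
  with refl ← var-≈-inv rh
  with s₂ , lj₂ , r₀ ← lam-≈-inv (≈v-lookupˡ rs i lj)
  = inj₂ (_ , s-cp-in k _ (var x) As₂ i s₂ (VarReach-≈ rs (≈var x) v) lj₂ ,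
          ≈let k rs (≈-plugA (≈lam r₀) ras))
step-forward (≈let k rs rb) (vCpE _ _ _ i _ a As j _ rc lk v lj refl refl refl)
  with x , refl ← VarReach-var v
  with _ , a₂ ∷ As₂ , lk₂ , rh , ra ∷ ras ← plugA-≈-inv (var x) (a ∷ As) (λ ()) (≈v-lookupˡ rs i lk)
  with refl ← var-≈-inv rh
  with s₂ , lj₂ , r₀ ← lam-≈-inv (≈v-lookupˡ rs j lj)
  = inj₂ (_ , s-cp-e k _ _ i (var x) a₂ As₂ j s₂ (Reach-≈ rs rb rc) lk₂ (VarReach-≈ rs (≈var x) v) lj₂ ,
          ≈let k (≈v-update rs i (≈-plugA (≈lam r₀) (ra ∷ ras))) rb)

eval-forward : {A L : Term n} {ev : Evaluation n} → A ≈ L → IsEval A ev →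
               ∃ λ ev' → IsEval L ev' × SameChoices ev ev'
eval-forward rel (done w) = [] , done (WHNF-≈ rel w) , refl
eval-forward rel (step {ρ = ρ} st ev) with step-forward rel (proj₂ (view st))
... | inj₁ (refl , rel') = eval-forward rel' ev
... | inj₂ (L' , st' , rel') with ev' , evL' , same ← eval-forward rel' ev
  = _ , step st' evL' , cong (choice ρ) same

lamIndicator : Term n → ℕ
lamIndicator (lam _) = 1
lamIndicator _       = 0

mutual
  betaRedexes : Term n → ℕ
  betaRedexes (var _)       = 0
  betaRedexes (lam s)       = betaRedexes s
  betaRedexes (app f t)     = lamIndicator f + betaRedexes f + betaRedexes t
  betaRedexes (s ⊕ t)       = betaRedexes s + betaRedexes t
  betaRedexes (letr k es b) = betaRedexesV es + betaRedexes b

  betaRedexesV : ∀ {k} → Vec (Term n) k → ℕ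
  betaRedexesV []       = 0
  betaRedexesV (e ∷ es) = betaRedexes e + betaRedexesV es

lamIndicator-rename : ∀ {m n} (ρ : Fin m → Fin n) t → lamIndicator (rename ρ t) ≡ lamIndicator t
lamIndicator-rename ρ (var _)      = refl
lamIndicator-rename ρ (lam _)      = refl
lamIndicator-rename ρ (app _ _)    = refl
lamIndicator-rename ρ (_ ⊕ _)      = refl
lamIndicator-rename ρ (letr _ _ _) = refl

mutual
  betaRedexes-rename : ∀ {m n} (ρ : Fin m → Fin n) t → betaRedexes (rename ρ t) ≡ betaRedexes t
  betaRedexes-rename ρ (var _)       = refl
  betaRedexes-rename ρ (lam t)       = betaRedexes-rename _ t
  betaRedexes-rename ρ (app f t)     = cong₂ _+_ (cong₂ _+_ (lamIndicator-rename ρ f) (betaRedexes-rename ρ f))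
                                                 (betaRedexes-rename ρ t)
  betaRedexes-rename ρ (s ⊕ t)       = cong₂ _+_ (betaRedexes-rename ρ s) (betaRedexes-rename ρ t)
  betaRedexes-rename ρ (letr k es b) = cong₂ _+_ (betaRedexesV-rename _ es) (betaRedexes-rename _ b)

  betaRedexesV-rename : ∀ {m n k} (ρ : Fin m → Fin n) (es : Vec (Term m) k) →
                        betaRedexesV (renameVec ρ es) ≡ betaRedexesV es
  betaRedexesV-rename ρ []       = refl
  betaRedexesV-rename ρ (e ∷ es) = cong₂ _+_ (betaRedexes-rename ρ e) (betaRedexesV-rename ρ es)

betaRedexes-lbeta : (s : Term (suc n)) (u : Term n) →
                    betaRedexes (letr 1 (wk 1 u ∷ []) s) < betaRedexes (app (lam s) u)
betaRedexes-lbeta s u rewrite betaRedexes-rename (1 ↑ʳ_) u | +-identityʳ (betaRedexes u) =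
  s≤s (≤-reflexive (+-comm (betaRedexes u) (betaRedexes s)))

betaRedexes-plugA-< : {X Y : Term n} (As : List (Term n)) → lamIndicator X ≡ lamIndicator Y →
                      betaRedexes X < betaRedexes Y → betaRedexes (plugA X As) < betaRedexes (plugA Y As)
betaRedexes-plugA-< []       _  lt = lt
betaRedexes-plugA-< {X = X} {Y} (a ∷ As) lX≡lY lt = betaRedexes-plugA-< {X = app X a} {app Y a} As refl
  (+-monoˡ-< (betaRedexes a) (subst (λ z → z + betaRedexes X < lamIndicator Y + betaRedexes Y) (sym lX≡lY)
                                   (+-monoʳ-< (lamIndicator Y) lt)))

betaRedexesV-update-< : ∀ {k} (es : Vec (Term n) k) i x → betaRedexes x < betaRedexes (lookup es i) →
                        betaRedexesV (es [ i ]≔ x) < betaRedexesV es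
betaRedexesV-update-< (e ∷ es) zero    x lt = +-monoˡ-< (betaRedexesV es) lt
betaRedexesV-update-< (e ∷ es) (suc i) x lt = +-monoʳ-< (betaRedexes e) (betaRedexesV-update-< es i x lt)

lbeta-decreases-betaRedexes : {A A₁ : Term n} → Step A lbeta A₁ → betaRedexes A₁ < betaRedexes A
lbeta-decreases-betaRedexes (inA As (r-lbeta s u)) = betaRedexes-plugA-< As refl (betaRedexes-lbeta s u)
lbeta-decreases-betaRedexes (inLetA k es As (r-lbeta s u)) =
  +-monoʳ-< (betaRedexesV es) (betaRedexes-plugA-< As refl (betaRedexes-lbeta s u))
lbeta-decreases-betaRedexes (inLetCh k es b i As lk _ (r-lbeta s u)) =
  +-monoˡ-< (betaRedexes b) (betaRedexesV-update-< es i _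
    (subst (λ z → _ < betaRedexes z) (sym lk) (betaRedexes-plugA-< As refl (betaRedexes-lbeta s u))))

RootR-≈-backward : ∀ {h t₂ t₂' : Term n} {ρ} → h ≈ t₂ → RootR t₂ ρ t₂' →
                   (∃ λ h' → RootR h ρ h' × h' ≈ t₂') ⊎
                   (∃ λ G → ∃ λ v → ∃ λ G₁ → h ≡ app G v × RootR G lbeta G₁ × app G₁ v ≈ t₂)
RootR-≈-backward (≈app (≈lam rs) ru)      (r-lbeta _ _)    = inj₁ (_ , r-lbeta _ _ , lbeta-result-≈ rs ru)
RootR-≈-backward (≈or r₁ _)               (r-probl _ _)    = inj₁ (_ , r-probl _ _ , r₁)
RootR-≈-backward (≈or _ r₂)               (r-probr _ _)    = inj₁ (_ , r-probr _ _ , r₂)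
RootR-≈-backward (≈app (≈let k rs rb) ru) (r-lapp _ _ _ _) =
  inj₁ (_ , r-lapp _ _ _ _ , ≈let k rs (≈app rb (≈-rename _ ru)))
RootR-≈-backward (≈app (≈beta rs rt) ru)  (r-lapp _ _ _ _) =
  inj₂ (_ , _ , _ , refl , r-lbeta _ _ , ≈app (lbeta-result-≈ rs rt) ru)

BackwardStep : Term n → Term n → Rule → Term n → Set
BackwardStep A L ρ L' = (∃ λ A₁ → Step A lbeta A₁ × A₁ ≈ L) ⊎ (∃ λ A' → Step A ρ A' × A' ≈ L')

step-backward-letr : ∀ {κ k} {es es₂ : Vec (Term (k + n)) k} {b b₂ L' ρ} → es ≈v es₂ → b ≈ b₂ →
                     StepView (letr k es₂ b₂) ρ L' κ → BackwardStep (letr k es b) (letr k es₂ b₂) ρ L'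
step-backward-letr rs rb (vA As₂ r e _) = ⊥-elim (plugA-RootR-≢-letr r As₂ (sym e))
step-backward-letr {k = k} rs rb (vLetA _ _ _ As₂ r refl refl refl)
  with _ , As , refl , rh , ras ← ≈-plugA-inv _ As₂ rb
  with RootR-≈-backward rh r
... | inj₁ (_ , r' , rt)                   = inj₂ (_ , inLetA k _ As r' , ≈let k rs (≈-plugA rt ras))
... | inj₂ (_ , v , _ , refl , rG , rt)    = inj₁ (_ , inLetA k _ (v ∷ As) rG , ≈let k rs (≈-plugA rt ras))
step-backward-letr {k = k} rs rb (vLetCh _ _ _ i As₂ lk rc r refl refl)
  with _ , As , lk₁ , rh , ras ← ≈-plugA-inv _ As₂ (≈v-lookupʳ rs i lk)
  with RootR-≈-backward rh r
... | inj₁ (_ , r' , rt) =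
  inj₂ (_ , inLetCh k _ _ i As lk₁ (Reach-≈⁻ rs rb rc) r' , ≈let k (≈v-update rs i (≈-plugA rt ras)) rb)
... | inj₂ (_ , v , _ , refl , rG , rt) =
  inj₁ (_ , inLetCh k _ _ i (v ∷ As) lk₁ (Reach-≈⁻ rs rb rc) rG ,
        ≈let k (≈v-updateˡ rs i (subst (_ ≈_) (sym lk) (≈-plugA rt ras))) rb)
step-backward-letr {k = k} rs rb (vLletIn _ _ k' _ _ refl refl refl) with ≈-letr-inv rb
... | inj₁ (es' , s , refl , rs' , r₀) = inj₂ (_ , s-llet-in k _ k' es' s , llet-in-result-≈ k k' rs rs' r₀)
... | inj₂ (_ , rx , r₁)               = inj₁ (_ , inLetA k _ [] rx , ≈let k rs r₁)
step-backward-letr {k = k} rs rb (vLletE _ _ _ i k' _ _ rc lk refl refl refl)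
  with ≈-letr-inv (≈v-lookupʳ rs i lk)
... | inj₁ (es' , s , lk₁ , rs' , r₀) =
  inj₂ (_ , s-llet-e k _ _ i k' es' s (Reach-≈⁻ rs rb rc) lk₁ , llet-e-result-≈ k i k' rs rb rs' r₀)
... | inj₂ (_ , rx , r₁) =
  inj₁ (_ , inLetCh k _ _ i [] refl (Reach-≈⁻ rs rb rc) rx ,
        ≈let k (≈v-updateˡ rs i (subst (_ ≈_) (sym lk) r₁)) rb)
step-backward-letr {k = k} rs rb (vCpIn _ _ _ _ As₂ i _ refl v lj refl refl refl)
  with x , refl ← VarReach-var v
  with _ , As , refl , rh , ras ← ≈-plugA-inv (var x) As₂ rb
  with refl ← ≈-var-inv rh
  with s , lj₁ , r₀ ← ≈-lam-inv (≈v-lookupʳ rs i lj)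
  = inj₂ (_ , s-cp-in k _ (var x) As i s (VarReach-≈⁻ rs (≈var x) v) lj₁ ,
          ≈let k rs (≈-plugA (≈lam r₀) ras))
step-backward-letr {k = k} rs rb (vCpE _ _ _ i _ a₂ As₂ j _ rc lk v lj refl refl refl)
  with x , refl ← VarReach-var v
  with _ , a ∷ As , lk₁ , rh , ra ∷ ras ← ≈-plugA-inv (var x) (a₂ ∷ As₂) (≈v-lookupʳ rs i lk)
  with refl ← ≈-var-inv rh
  with s , lj₁ , r₀ ← ≈-lam-inv (≈v-lookupʳ rs j lj)
  = inj₂ (_ , s-cp-e k _ _ i (var x) a As j s (Reach-≈⁻ rs rb rc) lk₁ (VarReach-≈⁻ rs (≈var x) v) lj₁ ,
          ≈let k (≈v-update rs i (≈-plugA (≈lam r₀) (ra ∷ ras))) rb)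

step-backward : ∀ {κ} {A L L' : Term n} {ρ} → A ≈ L → StepView L ρ L' κ → BackwardStep A L ρ L'
step-backward rel (vA As₂ r refl refl)
  with _ , As , refl , rh , ras ← ≈-plugA-inv _ As₂ rel
  with RootR-≈-backward rh r
... | inj₁ (_ , r' , rt)                = inj₂ (_ , inA As r' , ≈-plugA rt ras)
... | inj₂ (_ , v , _ , refl , rG , rt) = inj₁ (_ , inA (v ∷ As) rG , ≈-plugA rt ras)
step-backward (≈beta rs rt) _    = inj₁ (_ , inA [] (r-lbeta _ _) , lbeta-result-≈ rs rt)
step-backward (≈let _ rs rb) v   = step-backward-letr rs rb v

WHNF-≈⁻ : {A L : Term n} → A ≈ L → WHNF L → WHNF A ⊎ (∃ λ A₁ → Step A lbeta A₁ × WHNF A₁)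
WHNF-≈⁻ (≈lam _)            (whnf-lam _)     = inj₁ (whnf-lam _)
WHNF-≈⁻ (≈let k _ (≈lam _)) (whnf-let k _ _) = inj₁ (whnf-let k _ _)
WHNF-≈⁻ (≈beta (≈lam _) _)  (whnf-let _ _ _) = inj₂ (_ , inA [] (r-lbeta _ _) , whnf-let 1 _ _)

mutual
  eval-backward : {A L : Term n} {ev : Evaluation n} → A ≈ L → IsEval L ev →
                  ∃ λ ev' → IsEval A ev' × SameChoices ev ev'
  eval-backward rel (done w) with WHNF-≈⁻ rel w
  ... | inj₁ wA            = [] , done wA , refl
  ... | inj₂ (_ , st , w₁) = _ , step st (done w₁) , refl
  eval-backward rel (step st ev) = eval-backward-step rel st ev (<-wellFounded _)

  eval-backward-step : {A L L' : Term n} {ρ : Rule} {ev : Evaluation n} → A ≈ L → Step L ρ L' → IsEval L' ev →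
                       Acc _<_ (betaRedexes A) → ∃ λ ev' → IsEval A ev' × SameChoices ((ρ , L') ∷ ev) ev'
  eval-backward-step {ρ = ρ} rel st ev (acc smaller) with step-backward rel (proj₂ (view st))
  ... | inj₁ (_ , st₁ , rel₁)
    with _ , evA₁ , same ← eval-backward-step rel₁ st ev (smaller (lbeta-decreases-betaRedexes st₁))
    = _ , step st₁ evA₁ , same
  ... | inj₂ (_ , st' , rel')
    with _ , evA' , same ← eval-backward rel' ev
    = _ , step st' evA' , cong (choice ρ) same

proposition4p3 : ∀ {m : ℕ} (s : Term (suc m)) (t : Term m) →
    app (lam s) t ∼c letr 1 (wk 1 t ∷ []) s
proposition4p3 s t =
  (λ C → ExCv≤-by-simulation (eval-forward (≈-plug C redex≈let))) ,
  (λ C → ExCv≤-by-simulation (eval-backward (≈-plug C redex≈let)))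
  where
  redex≈let : app (lam s) t ≈ letr 1 (wk 1 t ∷ []) s
  redex≈let = ≈beta (≈-refl s) (≈-refl t)
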